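{- If $\Gamma;\Delta\vdash t:\rho$ in $\lambda\mu$T, then $\Gamma^*,\Delta^*\vdash t^*:\rho^*$ in $\lambda$T, where $\Gamma^*=\{x:\rho^*\mid x:\rho\in\Gamma\}$ and $\Delta^*=\{k_\alpha:\neg\rho^\circ\mid \alpha:\rho\in\Delta\}$.
   Context: $\lambda$T (Gödel's T): types $\rho ::= \mathbb N\mid\sigma\to\tau$; terms $t ::= x\mid\lambda x{:}\rho.r\mid ts\mid0\mid\mathsf S\,t\mid\mathsf{nrec}_\rho\ r\ s\ t$; typing $\Gamma\vdash t:\rho$ by the usual simply typed rules plus $\Gamma\vdash0:\mathbb N$, $\Gamma\vdash t:\mathbb N\Rightarrow\Gamma\vdash\mathsf S t:\mathbb N$, and $\Gamma\vdash r:\rho$, $\Gamma\vdash s:\mathbb N\to\rho\to\rho$, $\Gamma\vdash t:\mathbb N\Rightarrow\Gamma\vdash\mathsf{nrec}_\rho\ r\ s\ t:\rho$. $\lambda\mu$T: same types; terms/commands $t ::= x\mid\lambda x{:}\rho.r\mid ts\mid\mu\alpha{:}\rho.c\mid0\mid\mathsf S\,t\mid\mathsf{nrec}_\rho\ r\ s\ t$, $c::=[\alpha]t$ ($\alpha$ a $\mu$-variable); judgments $\Gamma;\Delta\vdash t:\rho$, $\Gamma;\Delta\vdash c$ given by the $\lambda$T rules (with $\Delta$ carried along) plus $\Gamma;\Delta,\alpha{:}\rho\vdash c\Rightarrow\Gamma;\Delta\vdash\mu\alpha{:}\rho.c:\rho$ and $\Gamma;\Delta\vdash t:\rho$, $\alpha:\rho\in\Delta\Rightarrow\Gamma;\Delta\vdash[\alpha]t$.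 CPS-translation: fix a $\lambda$T type $\bot$ and write $\neg\rho:=\rho\to\bot$. Types: $\rho^*:=\neg\neg\rho^\circ$, $\mathbb N^\circ:=\mathbb N$, $(\sigma\to\tau)^\circ:=\sigma^*\to\tau^*$. For $\lambda$T-terms, $t\bullet r:=\lambda k.t(\lambda l.lrk)$ and $\overline{\overline{t}}:=\lambda k.kt$. Terms (each $\mu$-variable $\alpha$ has an associated fresh $\lambda$-variable $k_\alpha$): $x^*:=\lambda k.xk$; $(\lambda x.t)^*:=\lambda k.k(\lambda x.t^*)$; $(tr)^*:=t^*\bullet r^*$; $0^*:=\overline{\overline{0}}$; $(\mathsf S t)^*:=\lambda k.t^*(\lambda l.k(\mathsf S l))$; $(\mathsf{nrec}_\rho\ r\ s\ t)^*:=\lambda k.t^*(\lambda l.\mathsf{nrec}\ r^*\ s'\ l\ k)$ with $s':=\lambda xp.(s^*\bullet\overline{\overline{x}})\bullet p$; $(\mu\alpha.c)^*:=\lambda k_\alpha.c^*$; $([\alpha]t)^*:=t^*k_\alpha$. -}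

module Defs where

open import Data.Nat using (ℕ; zero; suc; _+_)
open import Data.List using (List; []; _∷_)

infixr 7 _⇒_
data Ty : Set where
  `ℕ  : Ty
  _⇒_ : Ty → Ty → Ty

-- Typing contexts are lists of types; variables are de Bruijn indices
-- (index 0 = most recently bound / head of the list).
Ctx : Set
Ctx = List Ty

infix 4 _∋_⦂_
data _∋_⦂_ : Ctx → ℕ → Ty → Set where
  here  : ∀ {Γ A} → (A ∷ Γ) ∋ zero ⦂ A
  there : ∀ {Γ A B i} → Γ ∋ i ⦂ A → (B ∷ Γ) ∋ suc i ⦂ A

-- λT (Gödel's T).  The CPS translation of the paper writes its
-- λ-abstractions and recursors without type annotations, so the target
-- calculus is presented à la Curry (annotations erased).

data TTm : Set where
  var  : ℕ → TTm
  lam  : TTm → TTm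
  app  : TTm → TTm → TTm
  zer  : TTm
  succ : TTm → TTm
  nrec : TTm → TTm → TTm → TTm

infix 4 _⊢T_⦂_
data _⊢T_⦂_ : Ctx → TTm → Ty → Set where
  ⊢var  : ∀ {Γ i ρ} → Γ ∋ i ⦂ ρ → Γ ⊢T var i ⦂ ρ
  ⊢lam  : ∀ {Γ r σ τ} → (σ ∷ Γ) ⊢T r ⦂ τ → Γ ⊢T lam r ⦂ σ ⇒ τ
  ⊢app  : ∀ {Γ t s σ τ} → Γ ⊢T t ⦂ σ ⇒ τ → Γ ⊢T s ⦂ σ → Γ ⊢T app t s ⦂ τ
  ⊢zer  : ∀ {Γ} → Γ ⊢T zer ⦂ `ℕ
  ⊢succ : ∀ {Γ t} → Γ ⊢T t ⦂ `ℕ → Γ ⊢T succ t ⦂ `ℕ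
  ⊢nrec : ∀ {Γ r s t ρ} → Γ ⊢T r ⦂ ρ → Γ ⊢T s ⦂ `ℕ ⇒ ρ ⇒ ρ → Γ ⊢T t ⦂ `ℕ
        → Γ ⊢T nrec r s t ⦂ ρ

-- λμT (Church style, as in the paper).  λ-variables and μ-variables
-- live in separate de Bruijn namespaces (contexts Γ and Δ).

mutual
  data Tm : Set where
    var  : ℕ → Tm
    lam  : Ty → Tm → Tm
    app  : Tm → Tm → Tm
    mu   : Ty → Cmd → Tm
    zer  : Tm
    succ : Tm → Tm
    nrec : Ty → Tm → Tm → Tm → Tm

  data Cmd : Set where
    named : ℕ → Tm → Cmd

mutual
  infix 4 _︔_⊢_⦂_ _︔_⊢c_
  data _︔_⊢_⦂_ : Ctx → Ctx → Tm → Ty → Set where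
    ⊢var  : ∀ {Γ Δ i ρ} → Γ ∋ i ⦂ ρ → Γ ︔ Δ ⊢ var i ⦂ ρ
    ⊢lam  : ∀ {Γ Δ r σ τ} → (σ ∷ Γ) ︔ Δ ⊢ r ⦂ τ → Γ ︔ Δ ⊢ lam σ r ⦂ σ ⇒ τ
    ⊢app  : ∀ {Γ Δ t s σ τ} → Γ ︔ Δ ⊢ t ⦂ σ ⇒ τ → Γ ︔ Δ ⊢ s ⦂ σ
          → Γ ︔ Δ ⊢ app t s ⦂ τ
    ⊢mu   : ∀ {Γ Δ c ρ} → Γ ︔ (ρ ∷ Δ) ⊢c c → Γ ︔ Δ ⊢ mu ρ c ⦂ ρ
    ⊢zer  : ∀ {Γ Δ} → Γ ︔ Δ ⊢ zer ⦂ `ℕ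
    ⊢succ : ∀ {Γ Δ t} → Γ ︔ Δ ⊢ t ⦂ `ℕ → Γ ︔ Δ ⊢ succ t ⦂ `ℕ
    ⊢nrec : ∀ {Γ Δ r s t ρ} → Γ ︔ Δ ⊢ r ⦂ ρ → Γ ︔ Δ ⊢ s ⦂ `ℕ ⇒ ρ ⇒ ρ
          → Γ ︔ Δ ⊢ t ⦂ `ℕ → Γ ︔ Δ ⊢ nrec ρ r s t ⦂ ρ

  data _︔_⊢c_ : Ctx → Ctx → Cmd → Set where
    ⊢named : ∀ {Γ Δ α t ρ} → Γ ︔ Δ ⊢ t ⦂ ρ → Δ ∋ α ⦂ ρ → Γ ︔ Δ ⊢c named α t

¬[_]_ : Ty → Ty → Ty
¬[ ⊥ᵀ ] ρ = ρ ⇒ ⊥ᵀ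

mutual
  _°[_] : Ty → Ty → Ty
  `ℕ °[ ⊥ᵀ ] = `ℕ
  (σ ⇒ τ) °[ ⊥ᵀ ] = (σ *[ ⊥ᵀ ]) ⇒ (τ *[ ⊥ᵀ ])

  _*[_] : Ty → Ty → Ty
  ρ *[ ⊥ᵀ ] = ¬[ ⊥ᵀ ] (¬[ ⊥ᵀ ] (ρ °[ ⊥ᵀ ]))

-- Renaming / weakening of λT terms (needed for capture-free fresh
-- variables k, l, p, x in the translation).

ext : (ℕ → ℕ) → ℕ → ℕ
ext f zero    = zero
ext f (suc i) = suc (f i)

ren : (ℕ → ℕ) → TTm → TTm
ren f (var i)      = var (f i)
ren f (lam r)      = lam (ren (ext f) r)
ren f (app t s)    = app (ren f t) (ren f s)
ren f zer          = zer
ren f (succ t)     = succ (ren f t)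
ren f (nrec r s t) = nrec (ren f r) (ren f s) (ren f t)

wk : TTm → TTm
wk = ren suc

-- t • r := λk. t (λl. l r k)
_•_ : TTm → TTm → TTm
t • r = lam (app (wk t) (lam (app (app (var 0) (wk (wk r))) (var 1))))

-- ‾‾t := λk. k t
dbl : TTm → TTm
dbl t = lam (app (var 0) (wk t))

-- CPS translation of terms.  `cps ρx ρα t` translates t where the
-- λ-variable with source index i is the target variable ρx i and the
-- μ-variable α (source index j) corresponds to the target variable
-- k_α = ρα j.

mutual
  cps : (ℕ → ℕ) → (ℕ → ℕ) → Tm → TTm
  -- x* := λk. x k
  cps ρx ρα (var i)      = lam (app (var (suc (ρx i))) (var 0))
  -- (λx.t)* := λk. k (λx. t*)
  cps ρx ρα (lam σ t)    =
    lam (app (var 0) (lam (cps (ext (λ i → suc (ρx i)))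
                               (λ j → suc (suc (ρα j))) t)))
  -- (t r)* := t* • r*
  cps ρx ρα (app t r)    = cps ρx ρα t • cps ρx ρα r
  -- (μα.c)* := λk_α. c*
  cps ρx ρα (mu ρ c)     = lam (cpsc (λ i → suc (ρx i)) (ext ρα) c)
  -- 0* := ‾‾0
  cps ρx ρα zer          = dbl zer
  -- (S t)* := λk. t* (λl. k (S l))
  cps ρx ρα (succ t)     =
    lam (app (wk (cps ρx ρα t)) (lam (app (var 1) (succ (var 0)))))
  -- (nrec r s t)* := λk. t* (λl. nrec r* s' l k),  s' := λx p. (s* • ‾‾x) • p
  cps ρx ρα (nrec ρ r s t) =
    lam (app (wk (cps ρx ρα t))
             (lam (app (nrec (wk (wk (cps ρx ρα r)))
                             (wk (wk s′))
                             (var 0))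
                       (var 1))))
    where
      s′ : TTm
      s′ = lam (lam ((wk (wk (cps ρx ρα s)) • dbl (var 1)) • var 0))

  -- ([α]t)* := t* k_α
  cpsc : (ℕ → ℕ) → (ℕ → ℕ) → Cmd → TTm
  cpsc ρx ρα (named α t) = app (cps ρx ρα t) (var (ρα α))

module Submission where

-- The translation t* is defined relative to two maps sending source
-- λ-variables and μ-variables to target de Bruijn indices.  We prove a
-- stronger, inductive statement: if a target context Θ assigns type σ* to
-- the image of every λ-variable x : σ and type ¬σ° to the image k_α of
-- every μ-variable α : σ (a "CPS environment"), then Γ;Δ ⊢ t : ρ implies
-- Θ ⊢ t* : ρ*.
-- The theorem is the special case of the environment Γ* ++ Δ*, with λ-
-- variables at their own index and μ-variable j at index |Γ| + j.

open import Defs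
open import Data.Nat using (ℕ; zero; suc; _+_)
open import Data.List using (List; []; _∷_; map; length; _++_)

Ren : Ctx → Ctx → (ℕ → ℕ) → Set
Ren Θ Θ' f = ∀ {i A} → Θ ∋ i ⦂ A → Θ' ∋ f i ⦂ A

ext-Ren : ∀ {Θ Θ' f B} → Ren Θ Θ' f → Ren (B ∷ Θ) (B ∷ Θ') (ext f)
ext-Ren f here      = here
ext-Ren f (there x) = there (f x)

ren-typing : ∀ {Θ Θ' f t A} → Ren Θ Θ' f → Θ ⊢T t ⦂ A → Θ' ⊢T ren f t ⦂ A
ren-typing f (⊢var x)      = ⊢var (f x)
ren-typing f (⊢lam d)      = ⊢lam (ren-typing (ext-Ren f) d)
ren-typing f (⊢app d e)    = ⊢app (ren-typing f d) (ren-typing f e)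
ren-typing f ⊢zer          = ⊢zer
ren-typing f (⊢succ d)     = ⊢succ (ren-typing f d)
ren-typing f (⊢nrec d e g) = ⊢nrec (ren-typing f d) (ren-typing f e) (ren-typing f g)

wk-typing : ∀ {Θ t A B} → Θ ⊢T t ⦂ A → (B ∷ Θ) ⊢T wk t ⦂ A
wk-typing = ren-typing there

∋-map-++ˡ : ∀ {Γ i σ} (f : Ty → Ty) (E : Ctx) → Γ ∋ i ⦂ σ → (map f Γ ++ E) ∋ i ⦂ f σ
∋-map-++ˡ f E here      = here
∋-map-++ˡ f E (there x) = there (∋-map-++ˡ f E x)

∋-map-++ʳ : ∀ {E j A} (f : Ty → Ty) (Γ : Ctx) → E ∋ j ⦂ A → (map f Γ ++ E) ∋ length Γ + j ⦂ A
∋-map-++ʳ f []      y = y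
∋-map-++ʳ f (_ ∷ Γ) y = there (∋-map-++ʳ f Γ y)

∋-map : ∀ {Δ j σ} (g : Ty → Ty) → Δ ∋ j ⦂ σ → map g Δ ∋ j ⦂ g σ
∋-map g here      = here
∋-map g (there y) = there (∋-map g y)

S⋆ : TTm → TTm
S⋆ u = lam (app (wk u) (lam (app (var 1) (succ (var 0)))))

step⋆ : TTm → TTm
step⋆ s = lam (lam ((wk (wk s) • dbl (var 1)) • var 0))

nrec⋆ : TTm → TTm → TTm → TTm
nrec⋆ r s u = lam (app (wk u) (lam (app (nrec (wk (wk r)) (wk (wk (step⋆ s))) (var 0)) (var 1))))

module CPS (⊥ᵀ : Ty) where

  ¬_ : Ty → Ty
  ¬ A = ¬[ ⊥ᵀ ] A

  dbl-typing : ∀ {Θ t A} → Θ ⊢T t ⦂ A → Θ ⊢T dbl t ⦂ ¬ ¬ A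
  dbl-typing d = ⊢lam (⊢app (⊢var here) (wk-typing d))

  -- t • r = λk. t (λl. l r k)  applies a computation of a function to an
  -- argument; this is exactly the shape of (σ → τ)* = ¬¬(σ* → τ*).
  •-typing : ∀ {Θ t r A B} → Θ ⊢T t ⦂ ¬ ¬ (A ⇒ ¬ ¬ B) → Θ ⊢T r ⦂ A
           → Θ ⊢T t • r ⦂ ¬ ¬ B
  •-typing d e =
    ⊢lam (⊢app (wk-typing d)
               (⊢lam (⊢app (⊢app (⊢var here) (wk-typing (wk-typing e)))
                           (⊢var (there here)))))

  S⋆-typing : ∀ {Θ u} → Θ ⊢T u ⦂ ¬ ¬ `ℕ → Θ ⊢T S⋆ u ⦂ ¬ ¬ `ℕ
  S⋆-typing d =
    ⊢lam (⊢app (wk-typing d) (⊢lam (⊢app (⊢var (there here)) (⊢succ (⊢var here)))))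

  -- The step function s' of the recursor has type ℕ → ρ* → ρ*, since it
  -- only needs s : (ℕ → ρ → ρ)* = ¬¬(ℕ* → ¬¬(ρ* → ρ*)).
  step⋆-typing : ∀ {Θ s ρ} → Θ ⊢T s ⦂ (`ℕ ⇒ ρ ⇒ ρ) *[ ⊥ᵀ ]
               → Θ ⊢T step⋆ s ⦂ `ℕ ⇒ ρ *[ ⊥ᵀ ] ⇒ ρ *[ ⊥ᵀ ]
  step⋆-typing d =
    ⊢lam (⊢lam (•-typing (•-typing (wk-typing (wk-typing d))
                                   (dbl-typing (⊢var (there here))))
                         (⊢var here)))

  -- The recursor wrapper: the numeral is evaluated first, then the
  -- recursion runs in λT at type ρ* and is fed the continuation.
  nrec⋆-typing : ∀ {Θ r s u ρ} → Θ ⊢T r ⦂ ρ *[ ⊥ᵀ ] → Θ ⊢T s ⦂ (`ℕ ⇒ ρ ⇒ ρ) *[ ⊥ᵀ ]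
               → Θ ⊢T u ⦂ ¬ ¬ `ℕ → Θ ⊢T nrec⋆ r s u ⦂ ρ *[ ⊥ᵀ ]
  nrec⋆-typing dr ds du =
    ⊢lam (⊢app (wk-typing du)
               (⊢lam (⊢app (⊢nrec (wk-typing (wk-typing dr))
                                  (wk-typing (wk-typing (step⋆-typing ds)))
                                  (⊢var here))
                           (⊢var (there here)))))

  record Env (Γ Δ Θ : Ctx) (ρx ρα : ℕ → ℕ) : Set where
    field
      var-ok : ∀ {i σ} → Γ ∋ i ⦂ σ → Θ ∋ ρx i ⦂ σ *[ ⊥ᵀ ]
      cont-ok : ∀ {j σ} → Δ ∋ j ⦂ σ → Θ ∋ ρα j ⦂ ¬ (σ °[ ⊥ᵀ ])
  open Env

  -- Under (λx.t)* = λk. k (λx. t*), the variables k and x are bound: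
  -- x becomes the newest λ-variable, everything else shifts by two.
  Env-lam : ∀ {Γ Δ Θ ρx ρα σ K} → Env Γ Δ Θ ρx ρα
          → Env (σ ∷ Γ) Δ (σ *[ ⊥ᵀ ] ∷ K ∷ Θ) (ext (λ i → suc (ρx i))) (λ j → suc (suc (ρα j)))
  var-ok  (Env-lam E) here      = here
  var-ok  (Env-lam E) (there x) = there (there (var-ok E x))
  cont-ok (Env-lam E) y         = there (there (cont-ok E y))

  -- Under (μα.c)* = λk_α. c*, the continuation k_α is the newest variable.
  Env-mu : ∀ {Γ Δ Θ ρx ρα σ} → Env Γ Δ Θ ρx ρα
         → Env Γ (σ ∷ Δ) (¬ (σ °[ ⊥ᵀ ]) ∷ Θ) (λ i → suc (ρx i)) (ext ρα)
  var-ok  (Env-mu E) x         = there (var-ok E x)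
  cont-ok (Env-mu E) here      = here
  cont-ok (Env-mu E) (there y) = there (cont-ok E y)

  mutual
    cps-typing : ∀ {Γ Δ Θ ρx ρα t ρ} → Env Γ Δ Θ ρx ρα → Γ ︔ Δ ⊢ t ⦂ ρ
               → Θ ⊢T cps ρx ρα t ⦂ ρ *[ ⊥ᵀ ]
    cps-typing E (⊢var x)      = ⊢lam (⊢app (⊢var (there (var-ok E x))) (⊢var here))
    cps-typing E (⊢lam d)      = ⊢lam (⊢app (⊢var here) (⊢lam (cps-typing (Env-lam E) d)))
    cps-typing E (⊢app d e)    = •-typing (cps-typing E d) (cps-typing E e)
    cps-typing E (⊢mu c)       = ⊢lam (cpsc-typing (Env-mu E) c)
    cps-typing E ⊢zer          = dbl-typing ⊢zer
    cps-typing E (⊢succ d)     = S⋆-typing (cps-typing E d)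
    cps-typing E (⊢nrec d e f) = nrec⋆-typing (cps-typing E d) (cps-typing E e) (cps-typing E f)

    cpsc-typing : ∀ {Γ Δ Θ ρx ρα c} → Env Γ Δ Θ ρx ρα → Γ ︔ Δ ⊢c c
                → Θ ⊢T cpsc ρx ρα c ⦂ ⊥ᵀ
    cpsc-typing E (⊢named d α) = ⊢app (cps-typing E d) (⊢var (cont-ok E α))

  initial-Env : (Γ Δ : Ctx)
              → Env Γ Δ (map (_*[ ⊥ᵀ ]) Γ ++ map (λ σ → ¬ (σ °[ ⊥ᵀ ])) Δ)
                    (λ i → i) (λ j → length Γ + j)
  var-ok  (initial-Env Γ Δ) x = ∋-map-++ˡ _ _ x
  cont-ok (initial-Env Γ Δ) y = ∋-map-++ʳ _ Γ (∋-map _ y)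

theorem4p7 : (⊥ᵀ : Ty) (Γ Δ : List Ty) (t : Tm) (ρ : Ty)
    → Γ ︔ Δ ⊢ t ⦂ ρ
    → (map (λ σ → σ *[ ⊥ᵀ ]) Γ ++ map (λ σ → ¬[ ⊥ᵀ ] (σ °[ ⊥ᵀ ])) Δ)
        ⊢T cps (λ i → i) (λ j → length Γ + j) t ⦂ ρ *[ ⊥ᵀ ]
theorem4p7 ⊥ᵀ Γ Δ _ _ d = cps-typing (initial-Env Γ Δ) d
  where open CPS ⊥ᵀ
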